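{- Let $n\ge0$ and $\sigma\in C_{2n}(123)$. The path $\Phi(\sigma)$ is a Dyck path (i.e. ends on the $x$-axis) if and only if $\sigma$ has no tiny minimum.
   Context: $C_{2n}(123)$ is the set of permutations $\sigma$ of $[2n]=\{1,\dots,2n\}$ with $\sigma(i)+\sigma(2n+1-i)=2n+1$ for all $i$ and no $i<j<k$ with $\sigma(i)<\sigma(j)<\sigma(k)$. A Dyck prefix of length $m$ is a word in $U=(1,1)$, $D=(1,-1)$ of length $m$ whose lattice path from the origin never goes below the $x$-axis; a Dyck path is a Dyck prefix ending on the $x$-axis. For a set $S=\{s_1<\dots<s_r\}$ and a permutation $\tau$ of $[r]$, the word on $S$ order-isomorphic to $\tau$ is $s_{\tau(1)}\cdots s_{\tau(r)}$. Define $\Psi$ recursively from Dyck prefixes of length $2n$ to permutations of $[2n]$: the empty prefix goes to the empty permutation; for nonempty $\pi=U^jD^k\pi'$ ($j\ge1,k\ge0$ maximal), $\sigma=\Psi(\pi)$ is: (a) if $j\le n$: $\sigma(1)=2n+1-j$, $\sigma(i)=2n+2-i$ ($2\le i\le k$), $\sigma(2n)=j$, $\sigma(2n-i)=i$ ($1\le i\le k-1$), and $\sigma(k+1)\cdots\sigma(2n-k)$ is the word on $[2n]\setminus\{1,\dots,k-1,j,2n+1-j,2n-k+2,\dots,2n\}$ order-isomorphic to $\Psi(U^{j-k}\pi')$; (b) if $j=n+1$: $\sigma(1)=n$, $\sigma(i)=2n+2-i$ ($2\le i\le k+1$), $\sigma(2n)=n+1$, $\sigma(2n-i)=i$ ($1\le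 i\le k$), and $\sigma(k+2)\cdots\sigma(2n-k-1)$ is the word on $[2n]\setminus\{1,\dots,k,n,n+1,2n-k+1,\dots,2n\}$ order-isomorphic to $\Psi(U^{n-k-1}\pi')$; (c) if $j\ge n+2$: $\sigma(1)=n$, $\sigma(2n)=n+1$, and $\sigma(2)\cdots\sigma(2n-1)$ is the word on $[2n]\setminus\{n,n+1\}$ order-isomorphic to $\Psi(U^{j-2}D^k\pi')$. The paper shows $\Psi$ is a bijection onto $C_{2n}(123)$; $\Phi$ denotes its inverse. Tiny minima: let $w(\sigma)=\sigma(1)\cdots\sigma(n)=x_1w_1\cdots x_sw_s$, where $x_1,\dots,x_s$ are the values of the left-to-right minima of $\sigma$ (positions $i$ with $\sigma(i)\le\sigma(j)$ for all $j\le i$) among the first $n$ positions and $w_i$ is the possibly empty word between $x_i$ and $x_{i+1}$ (or the end). Let $A_0=[2n]$ and let $A_i$ be obtained from $A_{i-1}$ by removing $x_i$, $2n+1-x_i$, the entries of $w_i$ and their complements $2n+1-a$. For $A=\{s_1<\dots<s_{2h}\}$ put $m(A)=s_h$. The minimum $x_i$ is tiny if $x_i=m(A_{i-1})$. -}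

module Defs where

open import Data.Nat using (ℕ; zero; suc; _+_; _*_; _∸_; _≤_; _<_; _≤ᵇ_; _≡ᵇ_; _/_)
open import Data.Bool using (Bool; true; false; if_then_else_; not; _∨_)
open import Data.List using (List; []; _∷_; _++_; map; upTo; length; replicate; filterᵇ; [_])
open import Data.Bool.ListAction using (any)
open import Data.List.Relation.Binary.Permutation.Propositional using (_↭_)
open import Data.Product using (_×_; Σ; ∃; _,_)
open import Relation.Binary.PropositionalEquality using (_≡_)
open import Relation.Nullary using (¬_)

data Step : Set where
  U D : Step

-- Walk h π e : starting at height h, the path π never goes below the
-- x-axis and ends at height e.
data Walk : ℕ → List Step → ℕ → Set where
  done : ∀ {h} → Walk h [] h
  up   : ∀ {h π e} → Walk (suc h) π e → Walk h (U ∷ π) e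
  down : ∀ {h π e} → Walk h π e → Walk (suc h) (D ∷ π) e

DyckPrefix : List Step → Set
DyckPrefix π = ∃ λ e → Walk 0 π e

DyckPath : List Step → Set
DyckPath π = Walk 0 π 0

-- Words as lists, 1-indexed access (0 when out of range)

_!_ : List ℕ → ℕ → ℕ
[] ! _ = 0
(x ∷ xs) ! zero = 0
(x ∷ xs) ! suc zero = x
(x ∷ xs) ! suc (suc i) = xs ! suc i

range1 : ℕ → List ℕ
range1 m = map suc (upTo m)

downFrom1 : ℕ → List ℕ
downFrom1 zero = []
downFrom1 (suc k) = suc k ∷ downFrom1 k

_∈ᵇ_ : ℕ → List ℕ → Bool
v ∈ᵇ xs = any (λ r → v ≡ᵇ r) xs

without : ℕ → List ℕ → List ℕ
without N R = filterᵇ (λ v → not (v ∈ᵇ R)) (range1 N)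

-- the word on the ascending list S order-isomorphic to τ (a permutation of [|S|])
orderIso : List ℕ → List ℕ → List ℕ
orderIso S τ = map (λ v → S ! v) τ

countU : List Step → ℕ × List Step
countU (U ∷ π) with countU π
... | j , r = suc j , r
countU π = 0 , π

countD : List Step → ℕ × List Step
countD (D ∷ π) with countD π
... | k , r = suc k , r
countD π = 0 , π

-- The map Ψ.  psi fuel n π computes Ψ(π) for a Dyck prefix π of
-- length 2n; the fuel (initialised to n) only ensures termination:
-- every recursive call decreases n by at least one on valid inputs.

psi : ℕ → ℕ → List Step → List ℕ
psi zero n π = []
psi (suc fuel) zero π = []
psi (suc fuel) n π with countU π
... | j , rest with countD rest
... | k , π' =
  if j ≤ᵇ n then caseA
  else if j ≡ᵇ suc n then caseB
  else caseC
  where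
    N = n + n
    caseA : List ℕ
    caseA =
      let removed = range1 (k ∸ 1) ++ (j ∷ (N + 1 ∸ j) ∷ map (λ i → N + 1 ∸ i) (range1 (k ∸ 1)))
          sub = psi fuel (n ∸ k) (replicate (j ∸ k) U ++ π')
      in (N + 1 ∸ j) ∷ map (λ i → N + 1 ∸ i) (range1 (k ∸ 1))
           ++ orderIso (without N removed) sub
           ++ downFrom1 (k ∸ 1) ++ [ j ]
    caseB : List ℕ
    caseB =
      let removed = range1 k ++ (n ∷ suc n ∷ map (λ i → N + 1 ∸ i) (range1 k))
          sub = psi fuel (n ∸ k ∸ 1) (replicate (n ∸ k ∸ 1) U ++ π')
      in n ∷ map (λ i → N + 1 ∸ i) (range1 k)
           ++ orderIso (without N removed) sub
           ++ downFrom1 k ++ [ suc n ]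
    caseC : List ℕ
    caseC =
      let removed = n ∷ suc n ∷ []
          sub = psi fuel (n ∸ 1) (replicate (j ∸ 2) U ++ replicate k D ++ π')
      in n ∷ orderIso (without N removed) sub ++ [ suc n ]

Ψ : List Step → List ℕ
Ψ π = psi (length π / 2) (length π / 2) π

InC : ℕ → List ℕ → Set
InC n σ =
  (σ ↭ range1 (n + n))
  × (∀ i → 1 ≤ i → i ≤ n + n → σ ! i + σ ! (n + n + 1 ∸ i) ≡ n + n + 1)
  × ¬ (Σ ℕ λ i → Σ ℕ λ j → Σ ℕ λ k →
         1 ≤ i × i < j × j < k × k ≤ n + n
         × σ ! i < σ ! j × σ ! j < σ ! k)

IsLRMin : List ℕ → ℕ → Set
IsLRMin σ p = ∀ q → 1 ≤ q → q ≤ p → σ ! p ≤ σ ! q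

-- A before position p: [2n] minus σ(q) and 2n+1-σ(q) for all q < p.
-- If p is the position of the left-to-right minimum x_i, the positions
-- q < p are exactly those of x_1 w_1 ... x_{i-1} w_{i-1}, so this is A_{i-1}.
Abefore : ℕ → List ℕ → ℕ → List ℕ
Abefore n σ p =
  without (n + n)
    (map (λ q → σ ! q) (range1 (p ∸ 1)) ++ map (λ q → n + n + 1 ∸ σ ! q) (range1 (p ∸ 1)))

med : List ℕ → ℕ
med A = A ! (length A / 2)

HasTiny : ℕ → List ℕ → Set
HasTiny n σ = Σ ℕ λ p → 1 ≤ p × p ≤ n × IsLRMin σ p × σ ! p ≡ med (Abefore n σ p)

module Submission where

-- The proof follows the recursion of Ψ and shows more generally (tiny⇔unreturned): if π goes
-- from the axis to height e, then Ψ(π) has a tiny minimum iff e ≠ 0.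
--   * Cases (b), (c) of Ψ (j > n): σ(1) = n is the median of A_0 = [2n], hence a tiny minimum,
--     and a path of length 2n starting with more than n up-steps cannot return to the axis.
--   * Case (a) (1 ≤ k ≤ j ≤ n): σ = P · f(τ) · Q with τ = Ψ(U^(j-k) π′) and f the increasing
--     enumeration of the complement-closed set S of slots.  No position of P is tiny, and
--     A_{k+q}(σ) = f(A_q(τ)) (Abefore-embed), so the tiny minima of σ are exactly the shifted
--     ones of τ (Embedding.hasTiny-transfer); lowering the first peak U^k D^k of π keeps e.  The length and
-- range of Ψ(π) needed along the way are read off from the hypothesis σ ∈ C_{2n}(123).

open import Defs
open import Data.Nat using (ℕ; _+_)
open import Data.List using (List; length)
open import Relation.Binary.PropositionalEquality using (_≡_)
open import Relation.Nullary using (¬_)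
open import Function.Bundles using (_⇔_)

open import Data.Nat using (zero; suc; _∸_; _≤_; _<_; _≟_; _≤?_; z≤n; s≤s; _≡ᵇ_; _≤ᵇ_; _/_)
open import Data.Nat.Solver using (module +-*-Solver)
open +-*-Solver using (solve; _:+_; _:=_)
open import Data.Nat.DivMod using (m/n*n≤m; m*n/n≡m)
open import Data.Nat.Properties
open import Data.Bool using (Bool; true; false; not; T; T?)
open import Data.Unit using (tt)
open import Data.Bool.Properties using (T-≡)
open import Data.List using ([]; _∷_; _++_; map; applyUpTo; filterᵇ; reverse; [_]; replicate)
open import Data.List.Properties
  using (length-map; length-++; length-applyUpTo; map-applyUpTo; unfold-reverse; length-reverse; map-++;
         length-replicate)
open import Data.List.Membership.Propositional using (_∈_)
open import Data.List.Membership.Propositional.Properties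
  using (∈-map⁺; ∈-map⁻; ∈-++⁺ˡ; ∈-++⁺ʳ; ∈-++⁻; ∈-filter⁺; ∈-filter⁻; ∈-applyUpTo⁺; ∈-applyUpTo⁻)
open import Data.List.Relation.Unary.Any using (here; there)
import Data.List.Relation.Unary.Any as Any
open import Data.List.Relation.Unary.Any.Properties using (any⁺; any⁻; reverse⁺; reverse⁻)
open import Data.List.Relation.Unary.All using ([]; _∷_)
import Data.List.Relation.Unary.All as All
import Data.List.Relation.Unary.All.Properties as AllP
open import Data.List.Relation.Unary.AllPairs using (AllPairs; []; _∷_)
import Data.List.Relation.Unary.AllPairs.Properties as AllPairs
open import Data.Product using (_×_; Σ; _,_; proj₁; proj₂)
open import Data.Sum using (_⊎_; inj₁; inj₂)
open import Data.Empty using (⊥; ⊥-elim)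
open import Function.Base using (_∘_)
open import Function.Bundles using (mk⇔; Equivalence)
open import Function.Construct.Composition using (_⇔-∘_)
open import Relation.Binary.PropositionalEquality
  using (_≢_; refl; sym; trans; cong; cong₂; subst; subst₂; module ≡-Reasoning)
open import Relation.Nullary using (yes; no)
open import Data.List.Relation.Binary.Permutation.Propositional.Properties using (↭-length; ∈-resp-↭)
open import Data.List.Membership.DecPropositional _≟_ using (_∈?_)

!-zero : ∀ xs → xs ! 0 ≡ 0
!-zero [] = refl
!-zero (x ∷ xs) = refl

!-suc : ∀ x xs i → 1 ≤ i → (x ∷ xs) ! suc i ≡ xs ! i
!-suc x xs (suc i) _ = refl

!-out : ∀ xs i → length xs < i → xs ! i ≡ 0
!-out [] i _ = refl
!-out (x ∷ xs) (suc zero) (s≤s ())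
!-out (x ∷ xs) (suc (suc i)) (s≤s p) = !-out xs (suc i) p

!-nonzero : ∀ xs i → xs ! i ≢ 0 → 1 ≤ i × i ≤ length xs
!-nonzero xs zero ne = ⊥-elim (ne (!-zero xs))
!-nonzero xs (suc i) ne with suc i ≤? length xs
... | yes p = s≤s z≤n , p
... | no np = ⊥-elim (ne (!-out xs (suc i) (≰⇒> np)))

!-∈ : ∀ xs i → 1 ≤ i → i ≤ length xs → xs ! i ∈ xs
!-∈ (x ∷ xs) (suc zero) _ _ = here refl
!-∈ (x ∷ xs) (suc (suc i)) _ (s≤s p) = there (!-∈ xs (suc i) (s≤s z≤n) p)

∈-! : ∀ {x} xs → x ∈ xs → Σ ℕ λ i → 1 ≤ i × i ≤ length xs × xs ! i ≡ x
∈-! (y ∷ xs) (here refl) = 1 , s≤s z≤n , s≤s z≤n , refl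
∈-! (y ∷ xs) (there p) with ∈-! xs p
... | suc i , _ , i≤ , e = suc (suc i) , s≤s z≤n , s≤s i≤ , e

!-++ˡ : ∀ xs ys i → i ≤ length xs → (xs ++ ys) ! i ≡ xs ! i
!-++ˡ [] ys zero _ = !-zero ys
!-++ˡ (x ∷ xs) ys zero _ = refl
!-++ˡ (x ∷ xs) ys (suc zero) _ = refl
!-++ˡ (x ∷ xs) ys (suc (suc i)) (s≤s p) = !-++ˡ xs ys (suc i) p

!-++ʳ : ∀ xs ys i → (xs ++ ys) ! (length xs + suc i) ≡ ys ! suc i
!-++ʳ [] ys i = refl
!-++ʳ (x ∷ xs) ys i =
  trans (!-suc x (xs ++ ys) (length xs + suc i) (≤-trans (s≤s z≤n) (m≤n+m (suc i) (length xs))))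
        (!-++ʳ xs ys i)

!-map : ∀ (f : ℕ → ℕ) → f 0 ≡ 0 → ∀ xs i → map f xs ! i ≡ f (xs ! i)
!-map f f0 [] i = sym f0
!-map f f0 (x ∷ xs) zero = sym f0
!-map f f0 (x ∷ xs) (suc zero) = refl
!-map f f0 (x ∷ xs) (suc (suc i)) = !-map f f0 xs (suc i)

!-map-valid : ∀ (f : ℕ → ℕ) xs i → 1 ≤ i → i ≤ length xs → map f xs ! i ≡ f (xs ! i)
!-map-valid f (x ∷ xs) (suc zero) _ _ = refl
!-map-valid f (x ∷ xs) (suc (suc i)) _ (s≤s p) = !-map-valid f xs (suc i) (s≤s z≤n) p

reverse-! : ∀ xs i → 1 ≤ i → i ≤ length xs → reverse xs ! i ≡ xs ! (length xs + 1 ∸ i)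
reverse-! [] (suc i) _ ()
reverse-! (x ∷ xs) i i≥1 i≤ with i ≤? length xs
... | yes i≤xs = begin
    reverse (x ∷ xs) ! i
      ≡⟨ cong (_! i) (unfold-reverse x xs) ⟩
    (reverse xs ++ [ x ]) ! i
      ≡⟨ !-++ˡ (reverse xs) [ x ] i (subst (i ≤_) (sym (length-reverse xs)) i≤xs) ⟩
    reverse xs ! i
      ≡⟨ reverse-! xs i i≥1 i≤xs ⟩
    xs ! (length xs + 1 ∸ i)
      ≡⟨ sym (!-suc x xs _ (subst (1 ≤_) (sym (+-∸-comm 1 i≤xs)) (m≤n+m 1 _))) ⟩
    (x ∷ xs) ! suc (length xs + 1 ∸ i)
      ≡⟨ cong ((x ∷ xs) !_) (sym (+-∸-assoc 1 (≤-trans i≤xs (m≤m+n (length xs) 1)))) ⟩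
    (x ∷ xs) ! (suc (length xs) + 1 ∸ i) ∎
  where open ≡-Reasoning
... | no i≰xs with ≤-antisym i≤ (≰⇒> i≰xs)
...   | refl = begin
    reverse (x ∷ xs) ! suc (length xs)
      ≡⟨ cong (_! suc (length xs)) (unfold-reverse x xs) ⟩
    (reverse xs ++ [ x ]) ! suc (length xs)
      ≡⟨ cong (λ l → (reverse xs ++ [ x ]) ! suc l) (sym (length-reverse xs)) ⟩
    (reverse xs ++ [ x ]) ! suc (length (reverse xs))
      ≡⟨ cong ((reverse xs ++ [ x ]) !_) (+-comm 1 (length (reverse xs))) ⟩
    (reverse xs ++ [ x ]) ! (length (reverse xs) + 1)
      ≡⟨ !-++ʳ (reverse xs) [ x ] 0 ⟩
    x
      ≡⟨ cong ((x ∷ xs) !_) (sym (m+n∸m≡n (suc (length xs)) 1)) ⟩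
    (x ∷ xs) ! (suc (length xs) + 1 ∸ suc (length xs)) ∎
  where open ≡-Reasoning

range1≡applyUpTo : ∀ m → range1 m ≡ applyUpTo suc m
range1≡applyUpTo m = map-applyUpTo (λ i → i) suc m

applyUpTo-! : ∀ (f : ℕ → ℕ) l i → i < l → applyUpTo f l ! suc i ≡ f i
applyUpTo-! f (suc l) zero _ = refl
applyUpTo-! f (suc l) (suc i) (s≤s i<l) = applyUpTo-! (f ∘ suc) l i i<l

∈-range1⁻ : ∀ {x} m → x ∈ range1 m → 1 ≤ x × x ≤ m
∈-range1⁻ m x∈ with ∈-applyUpTo⁻ suc (subst (_ ∈_) (range1≡applyUpTo m) x∈)
... | i , i<m , refl = s≤s z≤n , i<m

∈-range1⁺ : ∀ {x} m → 1 ≤ x → x ≤ m → x ∈ range1 m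
∈-range1⁺ {suc x} m _ x<m = subst (_ ∈_) (sym (range1≡applyUpTo m)) (∈-applyUpTo⁺ suc x<m)

range1-! : ∀ m i → 1 ≤ i → i ≤ m → range1 m ! i ≡ i
range1-! m (suc i) _ i<m = trans (cong (_! suc i) (range1≡applyUpTo m)) (applyUpTo-! suc m i i<m)

length-range1 : ∀ m → length (range1 m) ≡ m
length-range1 m = trans (cong length (range1≡applyUpTo m)) (length-applyUpTo suc m)

∈ᵇ⇒∈ : ∀ v R → T (v ∈ᵇ R) → v ∈ R
∈ᵇ⇒∈ v R t = Any.map (≡ᵇ⇒≡ v _) (any⁻ _ R t)

∈⇒∈ᵇ : ∀ v R → v ∈ R → T (v ∈ᵇ R)
∈⇒∈ᵇ v R m = any⁺ _ (Any.map (≡⇒≡ᵇ v _) m)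

∈-without⁻ : ∀ {v} N R → v ∈ without N R → (1 ≤ v × v ≤ N) × ¬ v ∈ R
∈-without⁻ {v} N R m with ∈-filter⁻ (λ x → T? (not (x ∈ᵇ R))) {xs = range1 N} m
... | m′ , t = ∈-range1⁻ N m′ , λ r → not-T (∈⇒∈ᵇ v R r) t
  where
    not-T : ∀ {b} → T b → T (not b) → ⊥
    not-T {true} _ ()

∈-without⁺ : ∀ {v} N R → 1 ≤ v → v ≤ N → ¬ v ∈ R → v ∈ without N R
∈-without⁺ {v} N R v≥1 v≤N v∉R =
  ∈-filter⁺ (λ x → T? (not (x ∈ᵇ R))) (∈-range1⁺ N v≥1 v≤N) (not-F (λ t → v∉R (∈ᵇ⇒∈ v R t)))
  where
    not-F : ∀ {b} → ¬ T b → T (not b)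
    not-F {true} nb = nb tt
    not-F {false} _ = tt

length-partition : ∀ (p : ℕ → Bool) xs →
  length (filterᵇ p xs) + length (filterᵇ (not ∘ p) xs) ≡ length xs
length-partition p [] = refl
length-partition p (x ∷ xs) with p x
... | true = cong suc (length-partition p xs)
... | false = trans (+-suc _ _) (cong suc (length-partition p xs))

within : ℕ → List ℕ → List ℕ
within N R = filterᵇ (_∈ᵇ R) (range1 N)

∈-within⁻ : ∀ {v} N R → v ∈ within N R → v ∈ R
∈-within⁻ {v} N R v∈ = ∈ᵇ⇒∈ v R (proj₂ (∈-filter⁻ (λ x → T? (x ∈ᵇ R)) {xs = range1 N} v∈))

∈-within⁺ : ∀ {v} N R → 1 ≤ v → v ≤ N → v ∈ R → v ∈ within N R
∈-within⁺ {v} N R v≥1 v≤N v∈R = ∈-filter⁺ (λ x → T? (x ∈ᵇ R)) (∈-range1⁺ N v≥1 v≤N) (∈⇒∈ᵇ v R v∈R)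

length-without+within : ∀ N R → length (without N R) + length (within N R) ≡ N
length-without+within N R =
  trans (+-comm (length (without N R)) _) (trans (length-partition (_∈ᵇ R) (range1 N)) (length-range1 N))

-- Strictly increasing lists of naturals, i.e. finite sets listed in order.

Sorted : List ℕ → Set
Sorted = AllPairs _<_

sorted-ext : ∀ {xs ys} → Sorted xs → Sorted ys →
  (∀ x → x ∈ xs → x ∈ ys) → (∀ y → y ∈ ys → y ∈ xs) → xs ≡ ys
sorted-ext [] [] _ _ = refl
sorted-ext [] (_ ∷ _) _ ys⊆ with () ← ys⊆ _ (here refl)
sorted-ext (_ ∷ _) [] xs⊆ _ with () ← xs⊆ _ (here refl)
sorted-ext {x ∷ xs} {y ∷ ys} (x< ∷ sx) (y< ∷ sy) xs⊆ ys⊆ =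
  cong₂ _∷_ x≡y (sorted-ext sx sy xs⊆′ ys⊆′)
  where
    x≡y : x ≡ y
    x≡y with xs⊆ x (here refl) | ys⊆ y (here refl)
    ... | here e | _ = e
    ... | there _ | here e = sym e
    ... | there x∈ys | there y∈xs = ⊥-elim (<-asym (All.lookup y< x∈ys) (All.lookup x< y∈xs))
    xs⊆′ : ∀ z → z ∈ xs → z ∈ ys
    xs⊆′ z z∈xs with xs⊆ z (there z∈xs)
    ... | here e = ⊥-elim (<-irrefl (trans x≡y (sym e)) (All.lookup x< z∈xs))
    ... | there z∈ys = z∈ys
    ys⊆′ : ∀ z → z ∈ ys → z ∈ xs
    ys⊆′ z z∈ys with ys⊆ z (there z∈ys)
    ... | here e = ⊥-elim (<-irrefl (trans (sym x≡y) (sym e)) (All.lookup y< z∈ys))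
    ... | there z∈xs = z∈xs

sorted-< : ∀ {xs} → Sorted xs → ∀ a b → 1 ≤ a → a < b → b ≤ length xs → xs ! a < xs ! b
sorted-< _ (suc zero) (suc zero) _ (s≤s ()) _
sorted-< (x< ∷ sx) (suc zero) (suc (suc b)) _ _ (s≤s b≤) = All.lookup x< (!-∈ _ (suc b) (s≤s z≤n) b≤)
sorted-< (x< ∷ sx) (suc (suc a)) (suc (suc b)) _ (s≤s a<b) (s≤s b≤) =
  sorted-< sx (suc a) (suc b) (s≤s z≤n) a<b b≤

sorted-≤ : ∀ {xs} → Sorted xs → ∀ a b → 1 ≤ a → a ≤ b → b ≤ length xs → xs ! a ≤ xs ! b
sorted-≤ s a b a≥1 a≤b b≤ with m≤n⇒m<n∨m≡n a≤b
... | inj₁ a<b = <⇒≤ (sorted-< s a b a≥1 a<b b≤)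
... | inj₂ refl = ≤-refl

sorted-≤⁻ : ∀ {xs} → Sorted xs → ∀ a b → 1 ≤ a → a ≤ length xs → 1 ≤ b → b ≤ length xs →
  xs ! a ≤ xs ! b → a ≤ b
sorted-≤⁻ s a b _ a≤ b≥1 _ le with a ≤? b
... | yes a≤b = a≤b
... | no a≰b = ⊥-elim (<⇒≱ (sorted-< s b a b≥1 (≰⇒> a≰b) a≤) le)

sorted-inj : ∀ {xs} → Sorted xs → ∀ a b → 1 ≤ a → a ≤ length xs → 1 ≤ b → b ≤ length xs →
  xs ! a ≡ xs ! b → a ≡ b
sorted-inj s a b a≥1 a≤ b≥1 b≤ e =
  ≤-antisym (sorted-≤⁻ s a b a≥1 a≤ b≥1 b≤ (≤-reflexive e))
            (sorted-≤⁻ s b a b≥1 b≤ a≥1 a≤ (≤-reflexive (sym e)))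

sorted-map : ∀ {xs} (f : ℕ → ℕ) → Sorted xs →
  (∀ a b → a ∈ xs → b ∈ xs → a < b → f a < f b) → Sorted (map f xs)
sorted-map f [] mono = []
sorted-map {x ∷ xs} f (x< ∷ sx) mono =
  AllP.map⁺ (All.tabulate (λ {y} y∈xs → mono x y (here refl) (there y∈xs) (All.lookup x< y∈xs)))
  ∷ sorted-map f sx (λ a b a∈ b∈ → mono a b (there a∈) (there b∈))

sorted-range1 : ∀ m → Sorted (range1 m)
sorted-range1 m = subst Sorted (sym (range1≡applyUpTo m)) (AllPairs.applyUpTo⁺₁ suc m (λ i<j _ → s≤s i<j))

sorted-without : ∀ N R → Sorted (without N R)
sorted-without N R = AllPairs.filter⁺ _ (sorted-range1 N)

sorted-within : ∀ N R → Sorted (within N R)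
sorted-within N R = AllPairs.filter⁺ _ (sorted-range1 N)

InRange : ℕ → List ℕ → Set
InRange N A = ∀ x → x ∈ A → 1 ≤ x × x ≤ N

Closed : ℕ → List ℕ → Set
Closed N A = ∀ x → x ∈ A → N + 1 ∸ x ∈ A

compl-range : ∀ N x → 1 ≤ x → x ≤ N → 1 ≤ N + 1 ∸ x × N + 1 ∸ x ≤ N
compl-range N x x≥1 x≤N =
  subst (1 ≤_) (sym (+-∸-comm 1 x≤N)) (m≤n+m 1 _) ,
  subst (N + 1 ∸ x ≤_) (m+n∸n≡m N 1) (∸-monoʳ-≤ (N + 1) x≥1)

compl-< : ∀ N a b → a < b → b ≤ N → N + 1 ∸ b < N + 1 ∸ a
compl-< N a b a<b b≤N = ∸-monoʳ-< a<b (≤-trans b≤N (m≤m+n N 1))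

compl-involutive : ∀ N x → x ≤ N → N + 1 ∸ (N + 1 ∸ x) ≡ x
compl-involutive N x x≤N = m∸[m∸n]≡n (≤-trans x≤N (m≤m+n N 1))

compl-injective : ∀ N x y → x ≤ N → y ≤ N → N + 1 ∸ x ≡ N + 1 ∸ y → x ≡ y
compl-injective N x y x≤N y≤N e =
  trans (sym (compl-involutive N x x≤N)) (trans (cong (N + 1 ∸_) e) (compl-involutive N y y≤N))

sorted-snoc : ∀ {ys} z → Sorted ys → (∀ y → y ∈ ys → y < z) → Sorted (ys ++ [ z ])
sorted-snoc z sy below = AllPairs.++⁺ sy ([] ∷ []) (All.tabulate (λ {y} y∈ → below y y∈ ∷ []))

sorted-compl-reverse : ∀ N {A} → Sorted A → InRange N A → Sorted (map (λ x → N + 1 ∸ x) (reverse A))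
sorted-compl-reverse N [] _ = []
sorted-compl-reverse N {x ∷ A} (x< ∷ sA) r =
  subst Sorted (sym (trans (cong (map c) (unfold-reverse x A)) (map-++ c (reverse A) [ x ])))
    (sorted-snoc (c x) (sorted-compl-reverse N sA (λ y m → r y (there m))) below)
  where
    c : ℕ → ℕ
    c x = N + 1 ∸ x
    below : ∀ y → y ∈ map c (reverse A) → y < c x
    below y m with ∈-map⁻ c m
    ... | z , z∈ , refl = compl-< N x z (All.lookup x< (reverse⁻ z∈)) (proj₂ (r z (there (reverse⁻ z∈))))

closed-reverse : ∀ N {A} → Sorted A → InRange N A → Closed N A → A ≡ map (λ x → N + 1 ∸ x) (reverse A)
closed-reverse N {A} sA r cA = sorted-ext sA (sorted-compl-reverse N sA r) to from
  where
    to : ∀ y → y ∈ A → y ∈ map (λ x → N + 1 ∸ x) (reverse A)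
    to y m = subst (_∈ _) (compl-involutive N y (proj₂ (r y m)))
               (∈-map⁺ (λ x → N + 1 ∸ x) (reverse⁺ (cA y m)))
    from : ∀ y → y ∈ map (λ x → N + 1 ∸ x) (reverse A) → y ∈ A
    from y m with ∈-map⁻ (λ x → N + 1 ∸ x) m
    ... | z , z∈ , refl = cA z (reverse⁻ z∈)

closed-pairing : ∀ N {A} → Sorted A → InRange N A → Closed N A → ∀ i → 1 ≤ i → i ≤ length A →
  A ! i + A ! (length A + 1 ∸ i) ≡ N + 1
closed-pairing N {A} sA r cA i i≥1 i≤ = begin
    A ! i + a
      ≡⟨ cong (λ l → l ! i + a) (closed-reverse N sA r cA) ⟩
    map c (reverse A) ! i + a
      ≡⟨ cong (_+ a) (!-map-valid c (reverse A) i i≥1 (subst (i ≤_) (sym (length-reverse A)) i≤)) ⟩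
    c (reverse A ! i) + a
      ≡⟨ cong (λ t → c t + a) (reverse-! A i i≥1 i≤) ⟩
    N + 1 ∸ a + a
      ≡⟨ m∸n+n≡m (≤-trans (proj₂ (r a a∈A)) (m≤m+n N 1)) ⟩
    N + 1 ∎
  where
    open ≡-Reasoning
    c : ℕ → ℕ
    c x = N + 1 ∸ x
    j : ℕ
    j = length A + 1 ∸ i
    a : ℕ
    a = A ! j
    a∈A : a ∈ A
    a∈A = !-∈ A j (proj₁ (compl-range (length A) i i≥1 i≤)) (proj₂ (compl-range (length A) i i≥1 i≤))

-- The median m(A) of a closed set A ⊆ [1, 2M] is at most M: its h-th element is paired with the
-- (h+1)-st, a larger one, and the two sum to 2M+1.

smaller-of-pair : ∀ M a b → a < b → a + b ≡ M + M + 1 → a ≤ M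
smaller-of-pair M a b a<b sum with a ≤? M
... | yes a≤M = a≤M
... | no a≰M = ⊥-elim (<-irrefl refl (≤-trans too-big (≤-reflexive sum)))
  where
    open ≤-Reasoning
    too-big : M + M + 1 < a + b
    too-big = begin-strict
      M + M + 1        ≡⟨ +-comm (M + M) 1 ⟩
      suc (M + M)      <⟨ n<1+n _ ⟩
      suc (suc (M + M)) ≡⟨ cong suc (sym (+-suc M M)) ⟩
      suc M + suc M    ≤⟨ +-mono-≤ (≰⇒> a≰M) (≤-trans (≰⇒> a≰M) (<⇒≤ a<b)) ⟩
      a + b            ∎

lower-half-bound : ∀ M {A} → Sorted A → InRange (M + M) A → Closed (M + M) A →
  ∀ h → 1 ≤ h → h + h ≤ length A → A ! h ≤ M
lower-half-bound M {A} sA r cA h h≥1 2h≤ =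
  smaller-of-pair M (A ! h) (A ! j) (sorted-< sA h j h≥1 h<j j≤) (closed-pairing (M + M) sA r cA h h≥1 h≤)
  where
    L : ℕ
    L = length A
    j : ℕ
    j = L + 1 ∸ h
    h≤ : h ≤ L
    h≤ = ≤-trans (m≤m+n h h) 2h≤
    h<j : h < j
    h<j = begin-strict
      h                ≡⟨ sym (m+n∸m≡n h h) ⟩
      h + h ∸ h        <⟨ ∸-monoˡ-< (s≤s 2h≤) (m≤m+n h h) ⟩
      suc L ∸ h        ≡⟨ cong (_∸ h) (+-comm 1 L) ⟩
      j                ∎
      where open ≤-Reasoning
    j≤ : j ≤ L
    j≤ = subst (j ≤_) (m+n∸n≡m L 1) (∸-monoʳ-≤ (L + 1) h≥1)

med-bound : ∀ M {A} → Sorted A → InRange (M + M) A → Closed (M + M) A → med A ≢ 0 → med A ≤ M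
med-bound M {A} sA r cA med≢0 =
  lower-half-bound M sA r cA (length A / 2) (proj₁ (!-nonzero A _ med≢0)) half+half≤
  where
    half+half≤ : length A / 2 + length A / 2 ≤ length A
    half+half≤ = subst (_≤ length A) (trans (*-comm (length A / 2) 2) (cong (length A / 2 +_) (+-identityʳ _)))
                   (m/n*n≤m (length A) 2)

med-map : ∀ (f : ℕ → ℕ) → f 0 ≡ 0 → ∀ A → med (map f A) ≡ f (med A)
med-map f f0 A = trans (cong (λ l → map f A ! (l / 2)) (length-map f A)) (!-map f f0 A (length A / 2))

closed-without : ∀ M R → (∀ y → 1 ≤ y → y ≤ M → M + 1 ∸ y ∈ R → y ∈ R) → Closed M (without M R)
closed-without M R R-closed x x∈ with ∈-without⁻ M R x∈
... | (x≥1 , x≤M) , x∉R =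
  ∈-without⁺ M R (proj₁ (compl-range M x x≥1 x≤M)) (proj₂ (compl-range M x x≥1 x≤M))
    (λ cx∈R → x∉R (R-closed x x≥1 x≤M cx∈R))

Removed : ℕ → List ℕ → ℕ → List ℕ
Removed N σ p = map (σ !_) (range1 (p ∸ 1)) ++ map (λ q → N + 1 ∸ σ ! q) (range1 (p ∸ 1))

∈-Removed⁻ : ∀ {x} N σ p → x ∈ Removed N σ p →
  Σ ℕ λ i → (1 ≤ i × i ≤ p ∸ 1) × (x ≡ σ ! i ⊎ x ≡ N + 1 ∸ σ ! i)
∈-Removed⁻ N σ p x∈ with ∈-++⁻ (map (σ !_) (range1 (p ∸ 1))) x∈
... | inj₁ x∈₁ with ∈-map⁻ (σ !_) x∈₁
...   | i , i∈ , e = i , ∈-range1⁻ (p ∸ 1) i∈ , inj₁ e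
∈-Removed⁻ N σ p x∈ | inj₂ x∈₂ with ∈-map⁻ (λ q → N + 1 ∸ σ ! q) x∈₂
...   | i , i∈ , e = i , ∈-range1⁻ (p ∸ 1) i∈ , inj₂ e

∈-Removed⁺ : ∀ N σ p i → 1 ≤ i → i ≤ p ∸ 1 → σ ! i ∈ Removed N σ p
∈-Removed⁺ N σ p i i≥1 i≤ = ∈-++⁺ˡ (∈-map⁺ (σ !_) (∈-range1⁺ (p ∸ 1) i≥1 i≤))

∈-Removed⁺ᶜ : ∀ N σ p i → 1 ≤ i → i ≤ p ∸ 1 → N + 1 ∸ σ ! i ∈ Removed N σ p
∈-Removed⁺ᶜ N σ p i i≥1 i≤ =
  ∈-++⁺ʳ (map (σ !_) (range1 (p ∸ 1))) (∈-map⁺ (λ q → N + 1 ∸ σ ! q) (∈-range1⁺ (p ∸ 1) i≥1 i≤))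

Abefore-closed : ∀ n σ p → (∀ i → 1 ≤ i → i ≤ p ∸ 1 → σ ! i ≤ n + n) → Closed (n + n) (Abefore n σ p)
Abefore-closed n σ p bounded = closed-without N (Removed N σ p) R-closed
  where
    N : ℕ
    N = n + n
    R-closed : ∀ y → 1 ≤ y → y ≤ N → N + 1 ∸ y ∈ Removed N σ p → y ∈ Removed N σ p
    R-closed y _ y≤N cy∈ with ∈-Removed⁻ N σ p cy∈
    ... | i , (i≥1 , i≤) , inj₁ e =
      subst (_∈ Removed N σ p) (trans (cong (N + 1 ∸_) (sym e)) (compl-involutive N y y≤N))
        (∈-Removed⁺ᶜ N σ p i i≥1 i≤)
    ... | i , (i≥1 , i≤) , inj₂ e =
      subst (_∈ Removed N σ p) (sym (compl-injective N y (σ ! i) y≤N (bounded i i≥1 i≤) e))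
        (∈-Removed⁺ N σ p i i≥1 i≤)

med-Abefore-bound : ∀ n σ p → (∀ i → 1 ≤ i → i ≤ p ∸ 1 → σ ! i ≤ n + n) →
  med (Abefore n σ p) ≢ 0 → med (Abefore n σ p) ≤ n
med-Abefore-bound n σ p bounded =
  med-bound n (sorted-without (n + n) R) (λ x x∈ → proj₁ (∈-without⁻ (n + n) R x∈))
    (Abefore-closed n σ p bounded)
  where
    R : List ℕ
    R = Removed (n + n) σ p

Abefore-first : ∀ n σ → Abefore n σ 1 ≡ range1 (n + n)
Abefore-first n σ = keep-all (range1 (n + n))
  where
    keep-all : ∀ xs → filterᵇ (λ v → not (v ∈ᵇ [])) xs ≡ xs
    keep-all [] = refl
    keep-all (x ∷ xs) = cong (x ∷_) (keep-all xs)

half-double : ∀ n → (n + n) / 2 ≡ n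
half-double n = trans (cong (_/ 2) (trans (cong (n +_) (sym (+-identityʳ n))) (*-comm 2 n))) (m*n/n≡m n 2)

med-Abefore-first : ∀ n σ → 1 ≤ n → med (Abefore n σ 1) ≡ n
med-Abefore-first n σ n≥1 = begin
    med (Abefore n σ 1)
      ≡⟨ cong med (Abefore-first n σ) ⟩
    range1 (n + n) ! (length (range1 (n + n)) / 2)
      ≡⟨ cong (λ l → range1 (n + n) ! (l / 2)) (length-range1 (n + n)) ⟩
    range1 (n + n) ! ((n + n) / 2)
      ≡⟨ cong (range1 (n + n) !_) (half-double n) ⟩
    range1 (n + n) ! n
      ≡⟨ range1-! (n + n) n n≥1 (m≤m+n n n) ⟩
    n ∎
  where open ≡-Reasoning

TinyAt : ℕ → List ℕ → ℕ → Set
TinyAt n σ p = IsLRMin σ p × σ ! p ≡ med (Abefore n σ p)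

data Past (k : ℕ) : ℕ → Set where
  past : ∀ i′ → 1 ≤ i′ → Past k (k + i′)

past-of : ∀ {k i} → ¬ i ≤ k → Past k i
past-of {k} {i} i≰k =
  subst (Past k) (m+[n∸m]≡n (<⇒≤ (≰⇒> i≰k))) (past (i ∸ k) (m<n⇒0<n∸m (≰⇒> i≰k)))

-- The embedding lemma (case (a) of Ψ, one recursion step).
module Embedding
  (n k m : ℕ) (n≡k+m : n ≡ k + m) (P Q S τ : List ℕ)
  (|P| : length P ≡ k) (P-range : InRange (n + n) P)
  (|τ| : length τ ≡ m + m) (τ-range : InRange (m + m) τ)
  (|S| : length S ≡ m + m) (S-sorted : Sorted S) (S-range : InRange (n + n) S) (S-closed : Closed (n + n) S)
  (outside-S : ∀ x → 1 ≤ x → x ≤ n + n → ¬ x ∈ S → x ∈ P ⊎ n + n + 1 ∸ x ∈ P)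
  (P∩S : ∀ x → x ∈ P → ¬ x ∈ S)
  (P-large : ∀ x → x ∈ P → S ! m < x)
  where

  N M : ℕ
  N = n + n
  M = m + m

  f : ℕ → ℕ
  f v = S ! v

  σ : List ℕ
  σ = P ++ (map f τ ++ Q)

  σ-prefix : ∀ i → i ≤ k → σ ! i ≡ P ! i
  σ-prefix i i≤k = !-++ˡ P _ i (subst (i ≤_) (sym |P|) i≤k)

  σ-middle : ∀ q → 1 ≤ q → q ≤ M → σ ! (k + q) ≡ f (τ ! q)
  σ-middle (suc q) _ q≤M = begin
      σ ! (k + suc q)
        ≡⟨ cong (λ t → σ ! (t + suc q)) (sym |P|) ⟩
      σ ! (length P + suc q)
        ≡⟨ !-++ʳ P _ q ⟩
      (map f τ ++ Q) ! suc q
        ≡⟨ !-++ˡ (map f τ) Q (suc q) (subst (suc q ≤_) (sym (trans (length-map f τ) |τ|)) q≤M) ⟩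
      map f τ ! suc q
        ≡⟨ !-map f (!-zero S) τ (suc q) ⟩
      f (τ ! suc q) ∎
    where open ≡-Reasoning

  τ-entry : ∀ q → 1 ≤ q → q ≤ M → 1 ≤ τ ! q × τ ! q ≤ M
  τ-entry q q≥1 q≤M = τ-range (τ ! q) (!-∈ τ q q≥1 (subst (q ≤_) (sym |τ|) q≤M))

  S-bound : ∀ v → v ≤ M → v ≤ length S
  S-bound v v≤M = subst (v ≤_) (sym |S|) v≤M

  f∈S : ∀ v → 1 ≤ v → v ≤ M → f v ∈ S
  f∈S v v≥1 v≤M = !-∈ S v v≥1 (S-bound v v≤M)

  f-onto : ∀ x → x ∈ S → Σ ℕ λ u → 1 ≤ u × u ≤ M × f u ≡ x
  f-onto x x∈S with ∈-! S x∈S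
  ... | u , u≥1 , u≤ , e = u , u≥1 , subst (u ≤_) |S| u≤ , e

  f-< : ∀ a b → 1 ≤ a → a < b → b ≤ M → f a < f b
  f-< a b a≥1 a<b b≤M = sorted-< S-sorted a b a≥1 a<b (S-bound b b≤M)

  f-≤ : ∀ a b → 1 ≤ a → a ≤ b → b ≤ M → f a ≤ f b
  f-≤ a b a≥1 a≤b b≤M = sorted-≤ S-sorted a b a≥1 a≤b (S-bound b b≤M)

  f-≤⁻ : ∀ a b → 1 ≤ a → a ≤ M → 1 ≤ b → b ≤ M → f a ≤ f b → a ≤ b
  f-≤⁻ a b a≥1 a≤M b≥1 b≤M = sorted-≤⁻ S-sorted a b a≥1 (S-bound a a≤M) b≥1 (S-bound b b≤M)

  f-injective : ∀ a b → 1 ≤ a → a ≤ M → f a ≡ f b → a ≡ b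
  f-injective a b a≥1 a≤M e =
    sorted-inj S-sorted a b a≥1 (S-bound a a≤M) (proj₁ b-valid) (proj₂ b-valid) e
    where
      b-valid : 1 ≤ b × b ≤ length S
      b-valid = !-nonzero S b
        (λ fb≡0 → <⇒≢ (proj₁ (S-range (f a) (f∈S a a≥1 a≤M))) (sym (trans e fb≡0)))

  f-compl : ∀ v → 1 ≤ v → v ≤ M → f (M + 1 ∸ v) ≡ N + 1 ∸ f v
  f-compl v v≥1 v≤M = begin
      f (M + 1 ∸ v)
        ≡⟨ sym (m+n∸m≡n (f v) _) ⟩
      f v + f (M + 1 ∸ v) ∸ f v
        ≡⟨ cong (λ t → f v + f (t + 1 ∸ v) ∸ f v) (sym |S|) ⟩
      f v + f (length S + 1 ∸ v) ∸ f v
        ≡⟨ cong (_∸ f v) (closed-pairing N S-sorted S-range S-closed v v≥1 (S-bound v v≤M)) ⟩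
      N + 1 ∸ f v ∎
    where open ≡-Reasoning

  Rσ Rτ : ℕ → List ℕ
  Rσ q = Removed N σ (k + q)
  Rτ q = Removed M τ q

  prefix-before : ∀ q → 1 ≤ q → ∀ i → i ≤ k → i ≤ k + q ∸ 1
  prefix-before q q≥1 i i≤k =
    ≤-trans i≤k (≤-trans (m≤m+n k (q ∸ 1)) (≤-reflexive (sym (+-∸-assoc k q≥1))))

  middle-before : ∀ q → 1 ≤ q → ∀ i → i ≤ q ∸ 1 → k + i ≤ k + q ∸ 1
  middle-before q q≥1 i i≤ = ≤-trans (+-monoʳ-≤ k i≤) (≤-reflexive (sym (+-∸-assoc k q≥1)))

  middle-before⁻ : ∀ q → 1 ≤ q → ∀ i → k + i ≤ k + q ∸ 1 → i ≤ q ∸ 1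
  middle-before⁻ q q≥1 i i≤ = +-cancelˡ-≤ k i (q ∸ 1) (subst (k + i ≤_) (+-∸-assoc k q≥1) i≤)

  earlier-bound : ∀ q → q ≤ M → ∀ i → i ≤ q ∸ 1 → i ≤ M
  earlier-bound q q≤M i i≤ = ≤-trans i≤ (≤-trans (m∸n≤m q 1) q≤M)

  outside-S-removed : ∀ q → 1 ≤ q → ∀ x → 1 ≤ x → x ≤ N → ¬ x ∈ S → x ∈ Rσ q
  outside-S-removed q q≥1 x x≥1 x≤N x∉S with outside-S x x≥1 x≤N x∉S
  ... | inj₁ x∈P with ∈-! P x∈P
  ...   | i , i≥1 , i≤ , e =
    subst (_∈ Rσ q) (trans (σ-prefix i i≤k) e) (∈-Removed⁺ N σ (k + q) i i≥1 (prefix-before q q≥1 i i≤k))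
    where
      i≤k : i ≤ k
      i≤k = subst (i ≤_) |P| i≤
  outside-S-removed q q≥1 x x≥1 x≤N x∉S | inj₂ cx∈P with ∈-! P cx∈P
  ...   | i , i≥1 , i≤ , e =
    subst (_∈ Rσ q) (trans (cong (N + 1 ∸_) (trans (σ-prefix i i≤k) e)) (compl-involutive N x x≤N))
      (∈-Removed⁺ᶜ N σ (k + q) i i≥1 (prefix-before q q≥1 i i≤k))
    where
      i≤k : i ≤ k
      i≤k = subst (i ≤_) |P| i≤

  -- u is removed from τ before q iff f(u) is removed from σ before k+q (for u ∈ [1, 2m]); in
  -- the converse, an index in the prefix is impossible as P ∩ S = ∅ and S is closed.
  f-removed : ∀ q → 1 ≤ q → q ≤ M → ∀ u → u ∈ Rτ q → f u ∈ Rσ q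
  f-removed q q≥1 q≤M u u∈ with ∈-Removed⁻ M τ q u∈
  ... | i , (i≥1 , i≤) , inj₁ refl =
    subst (_∈ Rσ q) (σ-middle i i≥1 (earlier-bound q q≤M i i≤))
      (∈-Removed⁺ N σ (k + q) (k + i) (≤-trans i≥1 (m≤n+m i k)) (middle-before q q≥1 i i≤))
  ... | i , (i≥1 , i≤) , inj₂ refl =
    subst (_∈ Rσ q) (trans (cong (N + 1 ∸_) (σ-middle i i≥1 i≤M)) (sym (f-compl (τ ! i) t≥1 t≤M)))
      (∈-Removed⁺ᶜ N σ (k + q) (k + i) (≤-trans i≥1 (m≤n+m i k)) (middle-before q q≥1 i i≤))
    where
      i≤M : i ≤ M
      i≤M = earlier-bound q q≤M i i≤
      t≥1 : 1 ≤ τ ! i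
      t≥1 = proj₁ (τ-entry i i≥1 i≤M)
      t≤M : τ ! i ≤ M
      t≤M = proj₂ (τ-entry i i≥1 i≤M)

  f-removed⁻ : ∀ q → 1 ≤ q → q ≤ M → ∀ u → 1 ≤ u → u ≤ M → f u ∈ Rσ q → u ∈ Rτ q
  f-removed⁻ q q≥1 q≤M u u≥1 u≤M fu∈ with ∈-Removed⁻ N σ (k + q) fu∈
  ... | i , (i≥1 , i≤) , c with i ≤? k | c
  ...   | yes i≤k | inj₁ e =
    ⊥-elim (P∩S (f u) (subst (_∈ P) (sym (trans e (σ-prefix i i≤k))) Pi∈P) (f∈S u u≥1 u≤M))
    where
      Pi∈P : P ! i ∈ P
      Pi∈P = !-∈ P i i≥1 (subst (i ≤_) (sym |P|) i≤k)
  ...   | yes i≤k | inj₂ e =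
    ⊥-elim (P∩S (P ! i) Pi∈P (subst (_∈ S) Pi≡ (S-closed (f u) (f∈S u u≥1 u≤M))))
    where
      Pi∈P : P ! i ∈ P
      Pi∈P = !-∈ P i i≥1 (subst (i ≤_) (sym |P|) i≤k)
      Pi≡ : N + 1 ∸ f u ≡ P ! i
      Pi≡ = trans (cong (N + 1 ∸_) (trans e (cong (N + 1 ∸_) (σ-prefix i i≤k))))
                  (compl-involutive N (P ! i) (proj₂ (P-range (P ! i) Pi∈P)))
  ...   | no i≰k | c′ with past-of i≰k | c′
  ...     | past i′ i′≥1 | inj₁ e =
    subst (_∈ Rτ q) (sym (f-injective u (τ ! i′) u≥1 u≤M (trans e (σ-middle i′ i′≥1 i′≤M))))
      (∈-Removed⁺ M τ q i′ i′≥1 i′≤)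
    where
      i′≤ : i′ ≤ q ∸ 1
      i′≤ = middle-before⁻ q q≥1 i′ i≤
      i′≤M : i′ ≤ M
      i′≤M = earlier-bound q q≤M i′ i′≤
  ...     | past i′ i′≥1 | inj₂ e =
    subst (_∈ Rτ q) (sym (f-injective u _ u≥1 u≤M fu≡))
      (∈-Removed⁺ᶜ M τ q i′ i′≥1 i′≤)
    where
      i′≤ : i′ ≤ q ∸ 1
      i′≤ = middle-before⁻ q q≥1 i′ i≤
      i′≤M : i′ ≤ M
      i′≤M = earlier-bound q q≤M i′ i′≤
      t : 1 ≤ τ ! i′ × τ ! i′ ≤ M
      t = τ-entry i′ i′≥1 i′≤M
      fu≡ : f u ≡ f (M + 1 ∸ τ ! i′)
      fu≡ = trans e (trans (cong (N + 1 ∸_) (σ-middle i′ i′≥1 i′≤M))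
                           (sym (f-compl (τ ! i′) (proj₁ t) (proj₂ t))))

  Abefore-embed : ∀ q → 1 ≤ q → q ≤ M → Abefore n σ (k + q) ≡ map f (Abefore m τ q)
  Abefore-embed q q≥1 q≤M =
    sorted-ext (sorted-without N (Rσ q)) (sorted-map f (sorted-without M (Rτ q)) f-mono) to from
    where
      Aτ-range : ∀ {u} → u ∈ Abefore m τ q → 1 ≤ u × u ≤ M
      Aτ-range u∈ = proj₁ (∈-without⁻ M (Rτ q) u∈)
      f-mono : ∀ a b → a ∈ Abefore m τ q → b ∈ Abefore m τ q → a < b → f a < f b
      f-mono a b a∈ b∈ a<b = f-< a b (proj₁ (Aτ-range a∈)) a<b (proj₂ (Aτ-range b∈))
      to : ∀ x → x ∈ Abefore n σ (k + q) → x ∈ map f (Abefore m τ q)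
      to x x∈ with ∈-without⁻ N (Rσ q) x∈
      ... | (x≥1 , x≤N) , x∉R with x ∈? S
      ...   | no x∉S = ⊥-elim (x∉R (outside-S-removed q q≥1 x x≥1 x≤N x∉S))
      ...   | yes x∈S with f-onto x x∈S
      ...     | u , u≥1 , u≤M , refl =
        ∈-map⁺ f (∈-without⁺ M (Rτ q) u≥1 u≤M (λ u∈R → x∉R (f-removed q q≥1 q≤M u u∈R)))
      from : ∀ y → y ∈ map f (Abefore m τ q) → y ∈ Abefore n σ (k + q)
      from y y∈ with ∈-map⁻ f y∈
      ... | u , u∈ , refl with ∈-without⁻ M (Rτ q) u∈
      ...   | (u≥1 , u≤M) , u∉R =
        ∈-without⁺ N (Rσ q) (proj₁ fu-range) (proj₂ fu-range)
          (λ fu∈R → u∉R (f-removed⁻ q q≥1 q≤M u u≥1 u≤M fu∈R))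
        where
          fu-range : 1 ≤ f u × f u ≤ N
          fu-range = S-range (f u) (f∈S u u≥1 u≤M)

  med-embed : ∀ q → 1 ≤ q → q ≤ M → med (Abefore n σ (k + q)) ≡ f (med (Abefore m τ q))
  med-embed q q≥1 q≤M = trans (cong med (Abefore-embed q q≥1 q≤M)) (med-map f (!-zero S) (Abefore m τ q))

  -- For the converse direction the prefix has
  -- to be checked too: its entries exceed S ! m, which bounds f(τ ! q) since τ ! q is at most
  -- the median of a closed subset of [2m], hence at most m.

  tiny-σ⇒τ : ∀ q → 1 ≤ q → q ≤ m → TinyAt n σ (k + q) → TinyAt m τ q
  tiny-σ⇒τ q q≥1 q≤m (lrmin , tiny) = lrmin′ , tiny′
    where
      q≤M : q ≤ M
      q≤M = ≤-trans q≤m (m≤m+n m m)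
      t : 1 ≤ τ ! q × τ ! q ≤ M
      t = τ-entry q q≥1 q≤M
      tiny′ : τ ! q ≡ med (Abefore m τ q)
      tiny′ = f-injective (τ ! q) _ (proj₁ t) (proj₂ t)
                (trans (sym (σ-middle q q≥1 q≤M)) (trans tiny (med-embed q q≥1 q≤M)))
      lrmin′ : IsLRMin τ q
      lrmin′ q′ q′≥1 q′≤q = f-≤⁻ (τ ! q) (τ ! q′) (proj₁ t) (proj₂ t) (proj₁ t′) (proj₂ t′)
          (subst₂ _≤_ (σ-middle q q≥1 q≤M) (σ-middle q′ q′≥1 q′≤M)
             (lrmin (k + q′) (≤-trans q′≥1 (m≤n+m q′ k)) (+-monoʳ-≤ k q′≤q)))
        where
          q′≤M : q′ ≤ M
          q′≤M = ≤-trans q′≤q q≤M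
          t′ : 1 ≤ τ ! q′ × τ ! q′ ≤ M
          t′ = τ-entry q′ q′≥1 q′≤M

  tiny-τ⇒σ : ∀ q → 1 ≤ q → q ≤ m → TinyAt m τ q → TinyAt n σ (k + q)
  tiny-τ⇒σ q q≥1 q≤m (lrmin , tiny) = lrmin′ , tiny′
    where
      q≤M : q ≤ M
      q≤M = ≤-trans q≤m (m≤m+n m m)
      t : 1 ≤ τ ! q × τ ! q ≤ M
      t = τ-entry q q≥1 q≤M
      tiny′ : σ ! (k + q) ≡ med (Abefore n σ (k + q))
      tiny′ = trans (σ-middle q q≥1 q≤M) (trans (cong f tiny) (sym (med-embed q q≥1 q≤M)))
      τq≤m : τ ! q ≤ m
      τq≤m = subst (_≤ m) (sym tiny)
               (med-Abefore-bound m τ q (λ i i≥1 i≤ → proj₂ (τ-entry i i≥1 (earlier-bound q q≤M i i≤)))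
                  (λ med≡0 → <⇒≢ (proj₁ t) (sym (trans tiny med≡0))))
      lrmin′ : IsLRMin σ (k + q)
      lrmin′ i i≥1 i≤ with i ≤? k
      ... | yes i≤k = <⇒≤ (begin-strict
              σ ! (k + q)  ≡⟨ σ-middle q q≥1 q≤M ⟩
              f (τ ! q)    ≤⟨ f-≤ (τ ! q) m (proj₁ t) τq≤m (m≤m+n m m) ⟩
              S ! m        <⟨ P-large (P ! i) (!-∈ P i i≥1 (subst (i ≤_) (sym |P|) i≤k)) ⟩
              P ! i        ≡⟨ sym (σ-prefix i i≤k) ⟩
              σ ! i        ∎)
        where open ≤-Reasoning
      ... | no i≰k with past-of i≰k
      ...   | past i′ i′≥1 = begin
              σ ! (k + q)
                ≡⟨ σ-middle q q≥1 q≤M ⟩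
              f (τ ! q)
                ≤⟨ f-≤ (τ ! q) (τ ! i′) (proj₁ t) (lrmin i′ i′≥1 i′≤q) (proj₂ (τ-entry i′ i′≥1 (≤-trans i′≤q q≤M))) ⟩
              f (τ ! i′)
                ≡⟨ sym (σ-middle i′ i′≥1 (≤-trans i′≤q q≤M)) ⟩
              σ ! (k + i′) ∎
        where
          open ≤-Reasoning
          i′≤q : i′ ≤ q
          i′≤q = +-cancelˡ-≤ k i′ q i≤

  hasTiny-transfer : (∀ p → 1 ≤ p → p ≤ k → ¬ TinyAt n σ p) → HasTiny n σ ⇔ HasTiny m τ
  hasTiny-transfer no-prefix-tiny = mk⇔ to from
    where
      to : HasTiny n σ → HasTiny m τ
      to (p , p≥1 , p≤n , tiny) with p ≤? k
      ... | yes p≤k = ⊥-elim (no-prefix-tiny p p≥1 p≤k tiny)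
      ... | no p≰k with past-of p≰k
      ...   | past q q≥1 = q , q≥1 , q≤m , tiny-σ⇒τ q q≥1 q≤m tiny
        where
          q≤m : q ≤ m
          q≤m = +-cancelˡ-≤ k q m (subst (k + q ≤_) n≡k+m p≤n)
      from : HasTiny m τ → HasTiny n σ
      from (q , q≥1 , q≤m , tiny) =
        k + q , ≤-trans q≥1 (m≤n+m q k) , subst (k + q ≤_) (sym n≡k+m) (+-monoʳ-≤ k q≤m) ,
        tiny-τ⇒σ q q≥1 q≤m tiny

cancel-twice : ∀ a x m → a + a + x ≡ (a + m) + (a + m) → x ≡ m + m
cancel-twice a x m e = +-cancelˡ-≡ (a + a) x (m + m)
  (trans e (solve 2 (λ a m → (a :+ m) :+ (a :+ m) := (a :+ a) :+ (m :+ m)) refl a m))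

-- The sets of case (a) of Ψ for π = U^j D^(K+1) π′ (here n is half the length): the prefix
-- P = c(L) for the low values L = {j, 1, …, K} and c(x) = 2n+1-x, and the slots
-- S = [2n] \ (L ∪ c(L)) into which Ψ(U^(j-K-1) π′) is embedded order-isomorphically.

prefixA : ℕ → ℕ → ℕ → List ℕ
prefixA n j K = map (λ x → n + n + 1 ∸ x) (j ∷ range1 K)

slotsA : ℕ → ℕ → ℕ → List ℕ
slotsA n j K = without (n + n) (range1 K ++ (j ∷ prefixA n j K))

module CaseSets (n j K : ℕ) (K<j : suc K ≤ j) (j≤n : j ≤ n) where

  N k m : ℕ
  N = n + n
  k = suc K
  m = n ∸ k

  c : ℕ → ℕ
  c x = N + 1 ∸ x

  L P R S : List ℕ
  L = j ∷ range1 K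
  P = prefixA n j K
  R = range1 K ++ (j ∷ P)
  S = slotsA n j K

  n≡k+m : n ≡ k + m
  n≡k+m = sym (m+[n∸m]≡n (≤-trans K<j j≤n))

  |P| : length P ≡ k
  |P| = trans (length-map c L) (cong suc (length-range1 K))

  L-bound : ∀ {l} → l ∈ L → 1 ≤ l × l ≤ n
  L-bound (here refl) = ≤-trans (s≤s z≤n) K<j , j≤n
  L-bound (there l∈) with ∈-range1⁻ K l∈
  ... | l≥1 , l≤K = l≥1 , ≤-trans l≤K (≤-trans (n≤1+n K) (≤-trans K<j j≤n))

  L-range : InRange N L
  L-range l l∈ = proj₁ (L-bound l∈) , ≤-trans (proj₂ (L-bound l∈)) (m≤m+n n n)

  c-large : ∀ x → x ≤ n → n + 1 ≤ c x
  c-large x x≤n = begin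
      n + 1           ≡⟨ sym (m+n∸m≡n n (n + 1)) ⟩
      n + (n + 1) ∸ n ≡⟨ cong (_∸ n) (sym (+-assoc n n 1)) ⟩
      N + 1 ∸ n       ≤⟨ ∸-monoʳ-≤ (N + 1) x≤n ⟩
      c x             ∎
    where open ≤-Reasoning

  ∈-R⁻ : ∀ {x} → x ∈ R → x ∈ L ⊎ x ∈ P
  ∈-R⁻ x∈ with ∈-++⁻ (range1 K) x∈
  ... | inj₁ x∈low = inj₁ (there x∈low)
  ... | inj₂ (here refl) = inj₁ (here refl)
  ... | inj₂ (there x∈P) = inj₂ x∈P

  L⊆R : ∀ {x} → x ∈ L → x ∈ R
  L⊆R (here refl) = ∈-++⁺ʳ (range1 K) (here refl)
  L⊆R (there x∈) = ∈-++⁺ˡ x∈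

  P⊆R : ∀ {x} → x ∈ P → x ∈ R
  P⊆R x∈ = ∈-++⁺ʳ (range1 K) (there x∈)

  P-range : InRange N P
  P-range x x∈ with ∈-map⁻ c {xs = L} x∈
  ... | l , l∈ , refl = compl-range N l (proj₁ (L-range l l∈)) (proj₂ (L-range l l∈))

  S-sorted : Sorted S
  S-sorted = sorted-without N R

  S-range : InRange N S
  S-range x x∈ = proj₁ (∈-without⁻ N R x∈)

  P∩S : ∀ x → x ∈ P → ¬ x ∈ S
  P∩S x x∈P x∈S = proj₂ (∈-without⁻ N R x∈S) (P⊆R x∈P)

  outside-S : ∀ x → 1 ≤ x → x ≤ N → ¬ x ∈ S → x ∈ P ⊎ N + 1 ∸ x ∈ P
  outside-S x x≥1 x≤N x∉S with x ∈? R
  ... | no x∉R = ⊥-elim (x∉S (∈-without⁺ N R x≥1 x≤N x∉R))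
  ... | yes x∈R with ∈-R⁻ x∈R
  ...   | inj₁ x∈L = inj₂ (∈-map⁺ c x∈L)
  ...   | inj₂ x∈P = inj₁ x∈P

  S-closed : Closed N S
  S-closed = closed-without N R R-closed
    where
      R-closed : ∀ y → 1 ≤ y → y ≤ N → c y ∈ R → y ∈ R
      R-closed y _ y≤N cy∈ with ∈-R⁻ cy∈
      ... | inj₁ cy∈L = subst (_∈ R) (compl-involutive N y y≤N) (P⊆R (∈-map⁺ c cy∈L))
      ... | inj₂ cy∈P with ∈-map⁻ c {xs = L} cy∈P
      ...   | l , l∈ , e = subst (_∈ R) (sym (compl-injective N y l y≤N (proj₂ (L-range l l∈)) e)) (L⊆R l∈)

  -- The removed values L ∪ c(L), listed increasingly, number 2k; hence |S| = 2m.

  Low E : List ℕ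
  Low = range1 K ++ [ j ]
  E = Low ++ map c (reverse Low)

  Low⇒L : ∀ {x} → x ∈ Low → x ∈ L
  Low⇒L x∈ with ∈-++⁻ (range1 K) x∈
  ... | inj₁ x∈low = there x∈low
  ... | inj₂ (here refl) = here refl

  L⇒Low : ∀ {x} → x ∈ L → x ∈ Low
  L⇒Low (here refl) = ∈-++⁺ʳ (range1 K) (here refl)
  L⇒Low (there x∈) = ∈-++⁺ˡ x∈

  Low-sorted : Sorted Low
  Low-sorted = sorted-snoc j (sorted-range1 K) (λ y y∈ → ≤-trans (s≤s (proj₂ (∈-range1⁻ K y∈))) K<j)

  E-sorted : Sorted E
  E-sorted = AllPairs.++⁺ Low-sorted (sorted-compl-reverse N Low-sorted Low-range)
               (All.tabulate (λ l∈ → All.tabulate (λ y∈ → low<high l∈ y∈)))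
    where
      Low-range : InRange N Low
      Low-range x x∈ = L-range x (Low⇒L x∈)
      low<high : ∀ {x y} → x ∈ Low → y ∈ map c (reverse Low) → x < y
      low<high {x} x∈ y∈ with ∈-map⁻ c y∈
      ... | l , l∈ , refl = ≤-trans (s≤s (proj₂ (L-bound (Low⇒L x∈))))
                              (subst (_≤ c l) (+-comm n 1) (c-large l (proj₂ (L-bound (Low⇒L (reverse⁻ l∈))))))

  within-R≡E : within N R ≡ E
  within-R≡E = sorted-ext (sorted-within N R) E-sorted to from
    where
      to : ∀ x → x ∈ within N R → x ∈ E
      to x x∈ with ∈-R⁻ (∈-within⁻ N R x∈)
      ... | inj₁ x∈L = ∈-++⁺ˡ (L⇒Low x∈L)
      ... | inj₂ x∈P with ∈-map⁻ c {xs = L} x∈P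
      ...   | l , l∈ , refl = ∈-++⁺ʳ Low (∈-map⁺ c (reverse⁺ (L⇒Low l∈)))
      from : ∀ x → x ∈ E → x ∈ within N R
      from x x∈ with ∈-++⁻ Low x∈
      ... | inj₁ x∈Low = ∈-within⁺ N R (proj₁ (L-range x x∈L)) (proj₂ (L-range x x∈L)) (L⊆R x∈L)
        where
          x∈L : x ∈ L
          x∈L = Low⇒L x∈Low
      ... | inj₂ x∈cLow with ∈-map⁻ c x∈cLow
      ...   | l , l∈ , refl =
        ∈-within⁺ N R (proj₁ (P-range (c l) cl∈P)) (proj₂ (P-range (c l) cl∈P)) (P⊆R cl∈P)
        where
          cl∈P : c l ∈ P
          cl∈P = ∈-map⁺ c (Low⇒L (reverse⁻ l∈))

  |E| : length E ≡ k + k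
  |E| = begin
      length E
        ≡⟨ length-++ Low ⟩
      length Low + length (map c (reverse Low))
        ≡⟨ cong (length Low +_) (trans (length-map c (reverse Low)) (length-reverse Low)) ⟩
      length Low + length Low
        ≡⟨ cong (λ l → l + l) (trans (length-++ (range1 K)) (trans (cong (_+ 1) (length-range1 K)) (+-comm K 1))) ⟩
      k + k ∎
    where open ≡-Reasoning

  |S| : length S ≡ m + m
  |S| = cancel-twice k (length S) m (begin
      k + k + length S               ≡⟨ +-comm (k + k) (length S) ⟩
      length S + (k + k)             ≡⟨ cong (length S +_) (trans (sym |E|) (cong length (sym within-R≡E))) ⟩
      length S + length (within N R) ≡⟨ length-without+within N R ⟩
      n + n                          ≡⟨ cong₂ _+_ n≡k+m n≡k+m ⟩
      (k + m) + (k + m)              ∎)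
    where open ≡-Reasoning

  -- S ! m is the median of S, so it is at most n; every entry of P exceeds n.
  P-large : ∀ x → x ∈ P → S ! m < x
  P-large x x∈ with ∈-map⁻ c {xs = L} x∈
  ... | l , l∈ , refl = ≤-trans (s≤s Sm≤n) (subst (_≤ c l) (+-comm n 1) (c-large l (proj₂ (L-bound l∈))))
    where
      Sm≤n : S ! m ≤ n
      Sm≤n with m ≟ 0
      ... | yes m≡0 = subst (λ t → S ! t ≤ n) (sym m≡0) (subst (_≤ n) (sym (!-zero S)) z≤n)
      ... | no m≢0 = lower-half-bound n S-sorted S-range S-closed m (n≢0⇒n>0 m≢0) (≤-reflexive (sym |S|))

  -- No tiny minimum in the prefix: c(j) > n = m(A_0), and the later prefix entries exceed c(j).
  prefix-not-tiny : ∀ rest p → 1 ≤ p → p ≤ k → ¬ TinyAt n (P ++ rest) p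
  prefix-not-tiny rest (suc zero) _ _ (_ , tiny) =
    <-irrefl (sym tiny′) (subst (_≤ c j) (+-comm n 1) (c-large j j≤n))
    where
      tiny′ : c j ≡ n
      tiny′ = trans tiny (med-Abefore-first n (P ++ rest) (≤-trans (s≤s z≤n) (≤-trans K<j j≤n)))
  prefix-not-tiny rest (suc (suc p)) _ (s≤s sp≤K) (lrmin , _) =
    <⇒≱ (compl-< N (suc p) j (≤-trans (s≤s sp≤K) K<j) (proj₂ (L-range j (here refl))))
        (subst (_≤ c j) entry (lrmin 1 (s≤s z≤n) (s≤s z≤n)))
    where
      entry : (P ++ rest) ! suc (suc p) ≡ c (suc p)
      entry = begin
        (P ++ rest) ! suc (suc p)
          ≡⟨ !-++ˡ P rest (suc (suc p)) (subst (suc (suc p) ≤_) (sym |P|) (s≤s sp≤K)) ⟩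
        map c (range1 K) ! suc p
          ≡⟨ !-map-valid c (range1 K) (suc p) (s≤s z≤n) (subst (suc p ≤_) (sym (length-range1 K)) sp≤K) ⟩
        c (range1 K ! suc p)
          ≡⟨ cong c (range1-! K (suc p) (s≤s z≤n) sp≤K) ⟩
        c (suc p) ∎
        where open ≡-Reasoning

  middle-shape : ∀ τ Q → length Q ≡ k → let σ = P ++ (map (S !_) τ ++ Q) in
    length σ ≡ N → InRange N σ → length τ ≡ m + m × InRange (m + m) τ
  middle-shape τ Q |Q| |σ| σ-range = |τ| , τ-range
    where
      open ≡-Reasoning
      |τ| : length τ ≡ m + m
      |τ| = cancel-twice k (length τ) m (begin
        k + k + length τ
          ≡⟨ solve 2 (λ a t → a :+ a :+ t := a :+ (t :+ a)) refl k (length τ) ⟩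
        k + (length τ + k)
          ≡⟨ cong₂ (λ a b → a + (b + k)) (sym |P|) (sym (length-map (S !_) τ)) ⟩
        length P + (length (map (S !_) τ) + k)
          ≡⟨ cong (λ q → length P + (length (map (S !_) τ) + q)) (sym |Q|) ⟩
        length P + (length (map (S !_) τ) + length Q)
          ≡⟨ cong (length P +_) (sym (length-++ (map (S !_) τ))) ⟩
        length P + length (map (S !_) τ ++ Q)
          ≡⟨ sym (length-++ P) ⟩
        length (P ++ (map (S !_) τ ++ Q))
          ≡⟨ |σ| ⟩
        n + n
          ≡⟨ cong₂ _+_ n≡k+m n≡k+m ⟩
        (k + m) + (k + m) ∎)
      τ-range : InRange (m + m) τ
      τ-range t t∈ = proj₁ valid , subst (t ≤_) |S| (proj₂ valid)
        where
          St∈σ : S ! t ∈ P ++ (map (S !_) τ ++ Q)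
          St∈σ = ∈-++⁺ʳ P (∈-++⁺ˡ (∈-map⁺ (S !_) t∈))
          valid : 1 ≤ t × t ≤ length S
          valid = !-nonzero S t (λ St≡0 → <⇒≢ (proj₁ (σ-range (S ! t) St∈σ)) (sym St≡0))

  Q : List ℕ
  Q = downFrom1 K ++ [ j ]

  |Q| : length Q ≡ k
  |Q| = trans (length-++ (downFrom1 K)) (trans (cong (_+ 1) (length-downFrom1 K)) (+-comm K 1))
    where
      length-downFrom1 : ∀ a → length (downFrom1 a) ≡ a
      length-downFrom1 zero = refl
      length-downFrom1 (suc a) = cong suc (length-downFrom1 a)

  caseA-transfer : ∀ τ → let σ = P ++ (map (S !_) τ ++ Q) in length σ ≡ N → InRange N σ →
    length τ ≡ m + m × InRange (m + m) τ × (HasTiny n σ ⇔ HasTiny m τ)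
  caseA-transfer τ |σ| σ-range with middle-shape τ Q |Q| |σ| σ-range
  ... | |τ| , τ-range = |τ| , τ-range ,
    E.hasTiny-transfer (prefix-not-tiny (map (S !_) τ ++ Q))
    where
      module E = Embedding n k m n≡k+m P Q S τ |P| P-range |τ| τ-range |S| S-sorted S-range S-closed
                   outside-S P∩S P-large

walk-++ : ∀ {h e} xs ys → Walk h (xs ++ ys) e → Σ ℕ λ h′ → Walk h xs h′ × Walk h′ ys e
walk-++ [] ys w = _ , done , w
walk-++ (U ∷ xs) ys (up w) with walk-++ xs ys w
... | h′ , w₁ , w₂ = h′ , up w₁ , w₂
walk-++ (D ∷ xs) ys (down w) with walk-++ xs ys w
... | h′ , w₁ , w₂ = h′ , down w₁ , w₂

walk-++⁺ : ∀ {h h′ e} xs ys → Walk h xs h′ → Walk h′ ys e → Walk h (xs ++ ys) e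
walk-++⁺ [] ys done w = w
walk-++⁺ (U ∷ xs) ys (up w₁) w₂ = up (walk-++⁺ xs ys w₁ w₂)
walk-++⁺ (D ∷ xs) ys (down w₁) w₂ = down (walk-++⁺ xs ys w₁ w₂)

walk-Us : ∀ {h h′} j → Walk h (replicate j U) h′ → h′ ≡ j + h
walk-Us zero done = refl
walk-Us {h} (suc j) (up w) = trans (walk-Us j w) (+-suc j h)

walk-Us⁺ : ∀ h j → Walk h (replicate j U) (j + h)
walk-Us⁺ h zero = done
walk-Us⁺ h (suc j) = up (subst (Walk (suc h) (replicate j U)) (+-suc j h) (walk-Us⁺ (suc h) j))

walk-Ds : ∀ {h h′} k → Walk h (replicate k D) h′ → h ≡ k + h′
walk-Ds zero done = refl
walk-Ds (suc k) (down w) = cong suc (walk-Ds k w)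

walk-descent : ∀ {h π e} → Walk h π e → h ≤ e + length π
walk-descent done = m≤m+n _ 0
walk-descent {h} {U ∷ π} {e} (up w) =
  ≤-trans (n≤1+n h) (≤-trans (walk-descent w) (+-monoʳ-≤ e (n≤1+n (length π))))
walk-descent {suc h} {D ∷ π} {e} (down w) = subst (suc h ≤_) (sym (+-suc e (length π))) (s≤s (walk-descent w))

walk-end-unique : ∀ {h π e e′} → Walk h π e → Walk h π e′ → e ≡ e′
walk-end-unique done done = refl
walk-end-unique (up w) (up w′) = walk-end-unique w w′
walk-end-unique (down w) (down w′) = walk-end-unique w w′

countU-split : ∀ π → π ≡ replicate (proj₁ (countU π)) U ++ proj₂ (countU π)
countU-split [] = refl
countU-split (D ∷ π) = refl
countU-split (U ∷ π) = cong (U ∷_) (countU-split π)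

countD-split : ∀ π → π ≡ replicate (proj₁ (countD π)) D ++ proj₂ (countD π)
countD-split [] = refl
countD-split (U ∷ π) = refl
countD-split (D ∷ π) = cong (D ∷_) (countD-split π)

no-D-after-U-run : ∀ π → proj₁ (countD (proj₂ (countU π))) ≡ 0 → proj₂ (countU π) ≡ []
no-D-after-U-run [] _ = refl
no-D-after-U-run (U ∷ π) k≡0 = no-D-after-U-run π k≡0
no-D-after-U-run (D ∷ π) ()

data Runs (π : List Step) : Set where
  runs : ∀ j rest k π′ → countU π ≡ (j , rest) → countD rest ≡ (k , π′) →
    π ≡ replicate j U ++ (replicate k D ++ π′) → (k ≡ 0 → π′ ≡ []) → Runs π

runs-of : ∀ π → Runs π
runs-of π = runs _ _ _ _ refl refl
  (trans (countU-split π) (cong (replicate (proj₁ (countU π)) U ++_) (countD-split (proj₂ (countU π)))))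
  (λ k≡0 → cong (λ r → proj₂ (countD r)) (no-D-after-U-run π k≡0))


≤ᵇ-true : ∀ {a b} → a ≤ b → (a ≤ᵇ b) ≡ true
≤ᵇ-true a≤b = Equivalence.to T-≡ (≤⇒≤ᵇ a≤b)

≤ᵇ-false : ∀ {a b} → ¬ a ≤ b → (a ≤ᵇ b) ≡ false
≤ᵇ-false {a} {b} a≰b with a ≤ᵇ b in eq
... | true = ⊥-elim (a≰b (≤ᵇ⇒≤ a b (Equivalence.from T-≡ eq)))
... | false = refl

psi-caseA : ∀ fuel n π {j rest K π′} →
  countU π ≡ (j , rest) → countD rest ≡ (suc K , π′) → j ≤ suc n →
  psi (suc fuel) (suc n) π ≡
    prefixA (suc n) j K
      ++ (map (λ v → slotsA (suc n) j K ! v) (psi fuel (suc n ∸ suc K) (replicate (j ∸ suc K) U ++ π′))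
      ++ (downFrom1 K ++ [ j ]))
psi-caseA fuel n π eU eD j≤ rewrite eU | eD | ≤ᵇ-true j≤ = refl

psi-caseBC : ∀ fuel n π {j rest k π′} →
  countU π ≡ (j , rest) → countD rest ≡ (k , π′) → ¬ j ≤ suc n →
  Σ (List ℕ) λ t → psi (suc fuel) (suc n) π ≡ suc n ∷ t
psi-caseBC fuel n π {j} eU eD j≰ rewrite eU | eD | ≤ᵇ-false j≰ with j ≡ᵇ suc (suc n)
... | true = _ , refl
... | false = _ , refl

lower-first-peak : ∀ {e} j k π′ → Walk 0 (replicate j U ++ (replicate k D ++ π′)) e →
  k ≤ j × Walk 0 (replicate (j ∸ k) U ++ π′) e
lower-first-peak {e} j k π′ w with walk-++ (replicate j U) _ w
... | h , wU , w′ with walk-++ (replicate k D) π′ w′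
...   | h′ , wD , wπ′ =
  k≤j , walk-++⁺ (replicate (j ∸ k) U) π′ (walk-Us⁺ 0 (j ∸ k)) (subst (λ x → Walk x π′ e) h′≡ wπ′)
  where
    j≡k+h′ : j ≡ k + h′
    j≡k+h′ = trans (sym (+-identityʳ j)) (trans (sym (walk-Us j wU)) (walk-Ds k wD))
    k≤j : k ≤ j
    k≤j = subst (k ≤_) (sym j≡k+h′) (m≤m+n k h′)
    h′≡ : h′ ≡ j ∸ k + 0
    h′≡ = trans (sym (m+n∸m≡n k h′)) (trans (cong (_∸ k) (sym j≡k+h′)) (sym (+-identityʳ (j ∸ k))))

high-start-unreturned : ∀ {e} n j rest → n < j → j + length rest ≡ n + n →
  Walk 0 (replicate j U ++ rest) e → e ≢ 0
high-start-unreturned n j rest n<j |π| w refl with walk-++ (replicate j U) rest w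
... | h , wU , wrest = <⇒≱ (+-mono-< n<j n<j) (subst (j + j ≤_) |π| (+-monoʳ-≤ j j≤rest))
  where
    j≤rest : j ≤ length rest
    j≤rest = subst (_≤ length rest) (trans (walk-Us j wU) (+-identityʳ j)) (walk-descent wrest)

first-is-lrmin : ∀ σ → IsLRMin σ 1
first-is-lrmin [] q _ _ = z≤n
first-is-lrmin (x ∷ σ) (suc zero) _ _ = ≤-refl
first-is-lrmin (x ∷ σ) (suc (suc q)) _ (s≤s ())

starts-with-median : ∀ n t → 1 ≤ n → HasTiny n (n ∷ t)
starts-with-median n t n≥1 = 1 , ≤-refl , n≥1 , first-is-lrmin (n ∷ t) , sym (med-Abefore-first n (n ∷ t) n≥1)

length-run : ∀ (s : Step) j xs → length (replicate j s ++ xs) ≡ j + length xs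
length-run s j xs = trans (length-++ (replicate j s)) (cong (_+ length xs) (length-replicate j))

lowered-length : ∀ n j k ℓ → k ≤ j → k ≤ n →
  j + (k + ℓ) ≡ n + n → (j ∸ k) + ℓ ≡ (n ∸ k) + (n ∸ k)
lowered-length n j k ℓ k≤j k≤n e = cancel-twice k (j ∸ k + ℓ) (n ∸ k) (begin
    k + k + (j ∸ k + ℓ)
      ≡⟨ solve 3 (λ k d ℓ → k :+ k :+ (d :+ ℓ) := (k :+ d) :+ (k :+ ℓ)) refl k (j ∸ k) ℓ ⟩
    (k + (j ∸ k)) + (k + ℓ)     ≡⟨ cong (_+ (k + ℓ)) (m+[n∸m]≡n k≤j) ⟩
    j + (k + ℓ)                 ≡⟨ e ⟩
    n + n                       ≡⟨ cong₂ _+_ n≡ n≡ ⟩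
    (k + (n ∸ k)) + (k + (n ∸ k)) ∎)
  where
    open ≡-Reasoning
    n≡ : n ≡ k + (n ∸ k)
    n≡ = sym (m+[n∸m]≡n k≤n)

-- Main lemma, by induction along the recursion of Ψ: if π is a walk of length 2n from the axis
-- to height e, then Ψ(π) has a tiny minimum iff e ≠ 0.  The length and range of Ψ(π) are
-- assumed; they hold as Ψ(π) ∈ C_{2n}(123), and are inherited by the recursive image.
tiny⇔unreturned : ∀ fuel n π e → n ≤ fuel → length π ≡ n + n → Walk 0 π e →
  length (psi fuel n π) ≡ n + n → InRange (n + n) (psi fuel n π) →
  HasTiny n (psi fuel n π) ⇔ e ≢ 0
tiny⇔unreturned fuel zero [] e _ _ done _ _ =
  mk⇔ (λ { (p , p≥1 , p≤0 , _) → ⊥-elim (<⇒≱ p≥1 p≤0) }) (λ e≢0 → ⊥-elim (e≢0 refl))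
tiny⇔unreturned (suc fuel) (suc n) π e (s≤s n≤fuel) |π| w |σ| σ-range with runs-of π
... | runs j rest k π′ eU eD π≡ exhausted with j ≤? suc n
...   | no j≰ with psi-caseBC fuel n π eU eD j≰
...     | t , σ≡ rewrite σ≡ =
  mk⇔ (λ _ → high-start-unreturned (suc n) j _ (≰⇒> j≰)
                (trans (sym (length-run U j _)) (trans (cong length (sym π≡)) |π|))
                (subst (λ x → Walk 0 x e) π≡ w))
      (λ _ → starts-with-median (suc n) t (s≤s z≤n))
tiny⇔unreturned (suc fuel) (suc n) π e (s≤s n≤fuel) |π| w |σ| σ-range
  | runs j rest zero π′ eU eD π≡ exhausted | yes j≤ with exhausted refl
... | refl = ⊥-elim (<⇒≱ (m<m+n (suc n) (s≤s z≤n)) (subst (_≤ suc n) j≡ j≤))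
  where
    j≡ : j ≡ suc n + suc n
    j≡ = trans (sym (+-identityʳ j)) (trans (sym (length-run U j [])) (trans (cong length (sym π≡)) |π|))
tiny⇔unreturned (suc fuel) (suc n) π e (s≤s n≤fuel) |π| w |σ| σ-range
  | runs j rest (suc K) π′ eU eD π≡ exhausted | yes j≤
  with lower-first-peak j (suc K) π′ (subst (λ x → Walk 0 x e) π≡ w)
... | K<j , w′ with psi-caseA fuel n π eU eD j≤
...   | σ≡ with CaseSets.caseA-transfer (suc n) j K K<j j≤ _
                  (trans (cong length (sym σ≡)) |σ|) (subst (InRange (suc n + suc n)) σ≡ σ-range)
...     | |τ| , τ-range , σ⇔τ = subst (λ σ → HasTiny (suc n) σ ⇔ e ≢ 0) (sym σ≡) (IH ⇔-∘ σ⇔τ)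
  where
    |π′| : j + (suc K + length π′) ≡ suc n + suc n
    |π′| = trans (cong (j +_) (sym (length-run D (suc K) π′)))
             (trans (sym (length-run U j _)) (trans (cong length (sym π≡)) |π|))
    IH : HasTiny (n ∸ K) (psi fuel (n ∸ K) (replicate (j ∸ suc K) U ++ π′)) ⇔ e ≢ 0
    IH = tiny⇔unreturned fuel (n ∸ K) (replicate (j ∸ suc K) U ++ π′) e (≤-trans (m∸n≤m n K) n≤fuel)
           (trans (length-run U (j ∸ suc K) π′)
                  (lowered-length (suc n) j (suc K) (length π′) K<j (≤-trans K<j j≤) |π′|))
           w′ |τ| τ-range

Ψ-unfold : ∀ n π → length π ≡ n + n → Ψ π ≡ psi n n π
Ψ-unfold n π |π| = cong (λ h → psi h h π) (trans (cong (_/ 2) |π|) (half-double n))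

InC-shape : ∀ n σ → InC n σ → length σ ≡ n + n × InRange (n + n) σ
InC-shape n σ (σ↭ , _ , _) =
  trans (↭-length σ↭) (length-range1 (n + n)) ,
  λ x x∈ → ∈-range1⁻ (n + n) (∈-resp-↭ σ↭ x∈)

dyckPath⇔returns : ∀ {π e} → Walk 0 π e → DyckPath π ⇔ e ≡ 0
dyckPath⇔returns w = mk⇔ (walk-end-unique w) (λ { refl → w })

returns⇔¬ : ∀ {X : Set} e → X ⇔ e ≢ 0 → e ≡ 0 ⇔ (¬ X)
returns⇔¬ e X⇔ = mk⇔ (λ e≡0 x → Equivalence.to X⇔ x e≡0) from
  where
    from : ¬ _ → e ≡ 0
    from ¬x with e ≟ 0
    ... | yes e≡0 = e≡0
    ... | no e≢0 = ⊥-elim (¬x (Equivalence.from X⇔ e≢0))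

corollary8 : (n : ℕ) (σ : List ℕ) → InC n σ →
    (π : List Step) → DyckPrefix π → length π ≡ n + n → Ψ π ≡ σ →
    (DyckPath π ⇔ (¬ HasTiny n σ))
corollary8 n σ σ∈C π (e , w) |π| Ψπ≡σ = returns⇔¬ e tiny⇔ ⇔-∘ dyckPath⇔returns w
  where
    psi≡σ : psi n n π ≡ σ
    psi≡σ = trans (sym (Ψ-unfold n π |π|)) Ψπ≡σ
    shape : length σ ≡ n + n × InRange (n + n) σ
    shape = InC-shape n σ σ∈C
    tiny⇔ : HasTiny n σ ⇔ e ≢ 0
    tiny⇔ = subst (λ s → HasTiny n s ⇔ e ≢ 0) psi≡σ
      (tiny⇔unreturned n n π e ≤-refl |π| w
        (trans (cong length psi≡σ) (proj₁ shape)) (subst (InRange (n + n)) (sym psi≡σ) (proj₂ shape)))
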